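{- Let $G$ be a graph, let $H$ be a depth-$1$ vertex minor of $G$, and let $x,y\in V(H)$. Then $\mathrm{dist}_H(x,y)\ge\frac12\,\mathrm{dist}_G(x,y)$.
   Context: Graphs are finite and simple; distances may be infinite. For a vertex $v$, the local complementation $G\ast v$ complements the adjacency between every pair of distinct neighbours of $v$. For an independent set $I$ of $G$, $G\ast I$ is the successive local complementation of all vertices of $I$. A depth-$1$ vertex minor of $G$ is an induced subgraph of $G\ast I$ for some independent set $I$ of $G$. -}

module Defs where

open import Data.Nat using (ℕ; zero; suc; _+_; _≤_)
open import Data.Fin using (Fin)
open import Data.Fin.Properties using (_≟_)
open import Data.Bool using (Bool; true; false; not; _∧_; if_then_else_)
open import Data.List using (List; []; _∷_; foldl)
open import Data.List.Membership.Propositional using (_∈_)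
open import Data.List.Relation.Unary.Unique.Propositional using (Unique)
open import Data.Product using (_×_; ∃)
open import Relation.Nullary using (¬_; yes; no)
open import Relation.Binary.PropositionalEquality using (_≡_)

Adj : ℕ → Set
Adj n = Fin n → Fin n → Bool

record Simple {n : ℕ} (G : Adj n) : Set where
  field
    sym     : ∀ u v → G u v ≡ G v u
    irrefl  : ∀ v → G v v ≡ false

-- local complementation at v: complement adjacency between distinct neighbours of v
_⋆_ : {n : ℕ} → Adj n → Fin n → Adj n
(G ⋆ v) u w with u ≟ w
... | yes _ = G u w
... | no  _ = if G v u ∧ G v w then not (G u w) else G u w

_⋆*_ : {n : ℕ} → Adj n → List (Fin n) → Adj n
G ⋆* I = foldl _⋆_ G I

record Independent {n : ℕ} (G : Adj n) (I : List (Fin n)) : Set where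
  field
    unique : Unique I
    nonadj : ∀ {u v} → u ∈ I → v ∈ I → G u v ≡ false

VSet : ℕ → Set
VSet n = Fin n → Bool

-- walks of length k from x to y in the subgraph of G induced on S
data Walk {n : ℕ} (G : Adj n) (S : VSet n) : Fin n → Fin n → ℕ → Set where
  here : ∀ {x} → S x ≡ true → Walk G S x x zero
  step : ∀ {x y z k} → S x ≡ true → G x y ≡ true → Walk G S y z k → Walk G S x z (suc k)

Full : {n : ℕ} → VSet n
Full _ = true

data ℕ∞ : Set where
  fin : ℕ → ℕ∞
  ∞   : ℕ∞

data _≤∞_ : ℕ∞ → ℕ∞ → Set where
  fin≤fin : ∀ {a b} → a ≤ b → fin a ≤∞ fin b
  _≤∞∞    : ∀ a → a ≤∞ ∞

double : ℕ∞ → ℕ∞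
double (fin a) = fin (a + a)
double ∞ = ∞

data IsDist {n : ℕ} (G : Adj n) (S : VSet n) (x y : Fin n) : ℕ∞ → Set where
  finite   : ∀ {k} → Walk G S x y k → (∀ {j} → Walk G S x y j → k ≤ j) → IsDist G S x y (fin k)
  infinite : (∀ {j} → ¬ Walk G S x y j) → IsDist G S x y ∞

-- Local complementation at w only toggles pairs of neighbours of w, and it leaves the
-- neighbourhood of every vertex outside N(w) untouched. Since I is independent, the
-- neighbourhoods of vertices of I never change along G ⋆* I, so every edge of G ⋆* I is an
-- edge of G or joins two G-neighbours of a common vertex of I. Hence each edge of a walk in
-- H is replaced by a G-walk of length at most 2.
module Submission where

open import Defs
open import Data.Nat using (ℕ; suc; _+_; _*_; _≤_; z≤n; s≤s)
open import Data.Nat.Properties using (≤-trans; +-mono-≤; *-suc; +-identityʳ)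
open import Data.Fin using (Fin)
open import Data.Fin.Properties using (_≟_)
open import Data.Bool using (true; false; _∧_)
open import Data.Bool.Properties using (∧-conicalˡ; ∧-conicalʳ)
open import Data.List using (List; []; _∷_)
open import Data.List.Membership.Propositional using (_∈_)
open import Data.List.Relation.Unary.Any using (here; there)
open import Data.List.Relation.Binary.Subset.Propositional using (_⊆_)
open import Data.Product using (_×_; _,_; ∃-syntax)
open import Data.Sum using (_⊎_; inj₁; inj₂)
open import Data.Empty using (⊥-elim)
open import Relation.Nullary using (yes; no)
open import Relation.Binary.PropositionalEquality using (_≡_; refl; sym; trans; cong; subst)

private
  variable
    n : ℕ

⋆-fixes-non-neighbour : (H : Adj n) (w u v : Fin n) → H w u ≡ false → (H ⋆ w) u v ≡ H u v
⋆-fixes-non-neighbour H w u v wu≢ with u ≟ v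
... | yes _ = refl
... | no _ rewrite wu≢ = refl

⋆-edge : (H : Adj n) (w u v : Fin n) → (H ⋆ w) u v ≡ true →
         H u v ≡ true ⊎ H w u ∧ H w v ≡ true
⋆-edge H w u v e with u ≟ v
... | yes _ = inj₁ e
... | no _ with H w u ∧ H w v
...   | true  = inj₂ refl
...   | false = inj₁ e

Bridged : Adj n → List (Fin n) → Fin n → Fin n → Set
Bridged G I u v = ∃[ w ] w ∈ I × G w u ≡ true × G w v ≡ true

module _ {G : Adj n} {I : List (Fin n)} (ind : Independent G I) where
  open Independent ind

  KeepsRowsOf : Adj n → Set
  KeepsRowsOf H = ∀ {a} → a ∈ I → ∀ b → H a b ≡ G a b

  EdgesBridged : Adj n → Set
  EdgesBridged H = ∀ u v → H u v ≡ true → G u v ≡ true ⊎ Bridged G I u v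

  ⋆-keepsRowsOf : ∀ H {w} → w ∈ I → KeepsRowsOf H → KeepsRowsOf (H ⋆ w)
  ⋆-keepsRowsOf H {w} w∈I rows {a} a∈I b =
    trans (⋆-fixes-non-neighbour H w a b (trans (rows w∈I a) (nonadj w∈I a∈I))) (rows a∈I b)

  ⋆-edgesBridged : ∀ H {w} → w ∈ I → KeepsRowsOf H → EdgesBridged H → EdgesBridged (H ⋆ w)
  ⋆-edgesBridged H {w} w∈I rows bridged u v e with ⋆-edge H w u v e
  ... | inj₁ e′ = bridged u v e′
  ... | inj₂ wuv = inj₂ (w , w∈I , neighbour u (∧-conicalˡ _ _ wuv) , neighbour v (∧-conicalʳ _ _ wuv))
    where
      neighbour : ∀ x → H w x ≡ true → G w x ≡ true
      neighbour x wx = trans (sym (rows w∈I x)) wx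

  ⋆*-edgesBridged : ∀ H J → J ⊆ I → KeepsRowsOf H → EdgesBridged H → EdgesBridged (H ⋆* J)
  ⋆*-edgesBridged H []      _   _    bridged = bridged
  ⋆*-edgesBridged H (w ∷ J) J⊆I rows bridged =
    ⋆*-edgesBridged (H ⋆ w) J (λ x∈J → J⊆I (there x∈J))
      (⋆-keepsRowsOf H w∈I rows) (⋆-edgesBridged H w∈I rows bridged)
    where
      w∈I : w ∈ I
      w∈I = J⊆I (here refl)

  edgesBridged : EdgesBridged (G ⋆* I)
  edgesBridged = ⋆*-edgesBridged G I (λ x∈I → x∈I) (λ _ _ → refl) (λ _ _ → inj₁)

_++ʷ_ : {G : Adj n} {S : VSet n} {x y z : Fin n} {j k : ℕ} →
        Walk G S x y j → Walk G S y z k → Walk G S x z (j + k)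
here _       ++ʷ q = q
step s e p   ++ʷ q = step s e (p ++ʷ q)

walk-stretch : {G H : Adj n} {S : VSet n} (c : ℕ) →
               (∀ {u v} → H u v ≡ true → ∃[ j ] j ≤ c × Walk G Full u v j) →
               ∀ {x y k} → Walk H S x y k → ∃[ j ] j ≤ c * k × Walk G Full x y j
walk-stretch c short (here _) = 0 , z≤n , here refl
walk-stretch c short {k = suc k} (step _ e p) with short e | walk-stretch c short p
... | i , i≤c , q | j , j≤ck , r =
  i + j , subst (i + j ≤_) (sym (*-suc c k)) (+-mono-≤ i≤c j≤ck) , q ++ʷ r

⋆*-edge-length≤2 : {G : Adj n} → Simple G → {I : List (Fin n)} → Independent G I →
                   ∀ {u v} → (G ⋆* I) u v ≡ true → ∃[ j ] j ≤ 2 × Walk G Full u v j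
⋆*-edge-length≤2 simple ind {u} {v} e with edgesBridged ind u v e
... | inj₁ uv = 1 , s≤s z≤n , step refl uv (here refl)
... | inj₂ (w , _ , wu , wv) =
  2 , s≤s (s≤s z≤n) , step refl (trans (Simple.sym simple u w) wu) (step refl wv (here refl))

IsDist-≤-walk : {G : Adj n} {S : VSet n} {x y : Fin n} {d : ℕ∞} {j m : ℕ} →
                IsDist G S x y d → Walk G S x y j → j ≤ m → d ≤∞ fin m
IsDist-≤-walk (finite _ minimal) p j≤m = fin≤fin (≤-trans (minimal p) j≤m)
IsDist-≤-walk (infinite none)    p _   = ⊥-elim (none p)

lemma9 : ∀ {n : ℕ} (G : Adj n) → Simple G →
    (I : List (Fin n)) → Independent G I →
    (S : VSet n) → (x y : Fin n) → S x ≡ true → S y ≡ true →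
    (dH dG : ℕ∞) → IsDist (G ⋆* I) S x y dH → IsDist G Full x y dG →
    dG ≤∞ double dH
lemma9 G simple I ind S x y _ _ .∞ dG (infinite _) _ = dG ≤∞∞
lemma9 G simple I ind S x y _ _ (fin k) dG (finite p _) distG
  with walk-stretch 2 (⋆*-edge-length≤2 simple ind) p
... | j , j≤2k , q = IsDist-≤-walk distG q (subst (j ≤_) (cong (k +_) (+-identityʳ k)) j≤2k)
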